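{- Let an SCRN have $M$ reactions, each unimolecular or bimolecular, let $0<\rho<1$, and let $0<\varepsilon\le\frac{3}{4M}\left(1-\sqrt{\frac{1+\rho/9}{1+\rho}}\right)$. If $\vec{x}$ and $\vec{y}$ are states such that $|y_i-x_i|\le M\varepsilon x_i$ for every species $S_i$ (as is the case for any state $\vec{y}$ reached within a leap of bounded tau-leaping with all $\varepsilon_{ij}=\varepsilon$ started at $\vec{x}$), then for every reaction $R_j$, $(1-\rho)a_j(\vec{y})\le a_j(\vec{x})\le(1+\rho)a_j(\vec{y})$.
   Context: An SCRN has species $S_1,\dots,S_N$ and reactions $R_1,\dots,R_M$; states are vectors in $\mathbb{N}^N$. With volume $V>0$ the propensity of $R_j$ is $a_j(\vec{x})=k_jx_i$ for $S_i\to\dots$, $k_jx_ix_{i'}/V$ for $S_i+S_{i'}\to\dots$ ($i\ne i'$), and $k_jx_i(x_i-1)/(2V)$ for $2S_i\to\dots$, where $k_j>0$. In a leap of bounded tau-leaping started at $\vec{x}$ with bounds $\varepsilon_{ij}=\varepsilon$, each reaction changes the count of each species $S_i$ by at most $\varepsilon x_i$ in absolute value before the leap ends. -}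

module Defs where

open import Level using (Level; suc; _⊔_)
open import Data.Nat as ℕ using (ℕ; zero; suc; _∸_)
open import Data.Fin using (Fin)
open import Data.Product using (_×_)
open import Data.Sum using (_⊎_)
open import Relation.Binary.PropositionalEquality using (_≡_; _≢_)

-- An abstract ordered field (ℝ is an instance).  Inverse is total with
-- the convention that only x ≢ 0 is constrained.
record OrderedField (c ℓ : Level) : Set (Level.suc (c ⊔ ℓ)) where
  infixl 6 _+_ _-_
  infixl 7 _*_
  infix  4 _≤_ _<_
  field
    Carrier : Set c
    _+_ _*_ : Carrier → Carrier → Carrier
    -_      : Carrier → Carrier
    _⁻¹     : Carrier → Carrier
    0# 1#   : Carrier
    _≤_     : Carrier → Carrier → Set ℓ
    +-assoc      : ∀ x y z → (x + y) + z ≡ x + (y + z)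
    +-comm       : ∀ x y → x + y ≡ y + x
    +-identityˡ  : ∀ x → 0# + x ≡ x
    +-inverseˡ   : ∀ x → (- x) + x ≡ 0#
    *-assoc      : ∀ x y z → (x * y) * z ≡ x * (y * z)
    *-comm       : ∀ x y → x * y ≡ y * x
    *-identityˡ  : ∀ x → 1# * x ≡ x
    distribˡ     : ∀ x y z → x * (y + z) ≡ x * y + x * z
    0≢1          : 0# ≢ 1#
    *-inverseʳ   : ∀ x → x ≢ 0# → x * (x ⁻¹) ≡ 1#
    ≤-refl       : ∀ x → x ≤ x
    ≤-trans      : ∀ {x y z} → x ≤ y → y ≤ z → x ≤ z
    ≤-antisym    : ∀ {x y} → x ≤ y → y ≤ x → x ≡ y
    ≤-total      : ∀ x y → (x ≤ y) ⊎ (y ≤ x)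
    +-mono-≤     : ∀ {x y} z → x ≤ y → x + z ≤ y + z
    *-nonneg     : ∀ {x y} → 0# ≤ x → 0# ≤ y → 0# ≤ x * y

  _-_ : Carrier → Carrier → Carrier
  x - y = x + (- y)

  _<_ : Carrier → Carrier → Set (c ⊔ ℓ)
  x < y = (x ≤ y) × (x ≢ y)

  fromℕ : ℕ → Carrier
  fromℕ zero    = 0#
  fromℕ (suc n) = 1# + fromℕ n

  _/_ : Carrier → Carrier → Carrier
  x / y = x * (y ⁻¹)


-- Reactant side of a reaction: unimolecular S_i, bimolecular S_i + S_i'
-- with i ≢ i', or dimerisation 2 S_i.
data Reactants (N : ℕ) : Set where
  uni   : Fin N → Reactants N
  bi    : (i i' : Fin N) → i ≢ i' → Reactants N
  dimer : Fin N → Reactants N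

State : ℕ → Set
State N = Fin N → ℕ

module _ {c ℓ} (F : OrderedField c ℓ) where
  open OrderedField F

  record Reaction (N : ℕ) : Set (c ⊔ ℓ) where
    field
      reactants : Reactants N
      products  : Fin N → ℕ
      rate      : Carrier
      rate-pos  : 0# < rate

  record SCRN : Set (c ⊔ ℓ) where
    field
      N M       : ℕ
      reactions : Fin M → Reaction N

  propensityR : ∀ {N} → Reactants N → Carrier → Carrier → State N → Carrier
  propensityR (uni i)      k V x = k * fromℕ (x i)
  propensityR (bi i i' _)  k V x = (k * fromℕ (x i ℕ.* x i')) / V
  propensityR (dimer i)    k V x = (k * fromℕ (x i ℕ.* (x i ∸ 1))) / (fromℕ 2 * V)

  propensity : ∀ {N} → Reaction N → Carrier → State N → Carrier
  propensity r V x = propensityR (Reaction.reactants r) (Reaction.rate r) V x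

-- Put δ = M ε, so that |y_i - x_i| ≤ δ x_i for every species. Every propensity then satisfies
-- (1 - 2δ) a(x) ≤ a(y) and (1 - δ) a(y) ≤ (1 + δ) a(x): for S_i and S_i + S_i' this is the
-- elementary estimate for products, and for 2S_i it uses that x_i ≠ y_i forces δ x_i ≥ 1, which
-- absorbs the factor x_i - 1. These two inequalities give (1 - ρ) a(y) ≤ a(x) ≤ (1 + ρ) a(y) as soon
-- as 2δ (1 + ρ) ≤ ρ, and this is where the bound on ε enters: from s² (1 + ρ) = 1 + ρ/9 one gets
-- 9 (1 + ρ) (1 - s) (1 + s) = 8ρ and s ≥ 1/3, hence 2δ (1 + ρ) ≤ (3/2) (1 - s) (1 + ρ) = 4ρ / (3 (1 + s)) ≤ ρ.
module Submission where

open import Defs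
open import Data.Nat as ℕ using (ℕ; zero; suc)
open import Data.Integer as ℤ using (ℤ; -[1+_]; _⊖_; sign; ∣_∣; _◃_) renaming (+_ to pos)
import Data.Integer.Properties as ℤ
import Data.Nat.Properties as ℕ
open import Data.Sign as Sign using (Sign)
open import Data.Fin using (Fin)
open import Data.Product using (_×_; _,_; proj₁)
open import Data.Maybe using (Maybe; just; nothing)
open import Relation.Binary.PropositionalEquality
open import Relation.Nullary using (yes; no)
open import Data.Empty using (⊥-elim)
open import Algebra.Bundles using (CommutativeRing)
open import Algebra.Structures using (IsCommutativeRing)
import Algebra.Properties.Ring as RingProperties
import Algebra.Properties.CommutativeSemigroup as CommutativeSemigroupProperties
import Algebra.Properties.Semiring.Mult as SemiringMult
import Algebra.Properties.Semiring.Mult.TCOptimised as SemiringMultTC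
import Algebra.Solver.Ring.AlmostCommutativeRing as ACR
import Relation.Binary.Reasoning.Preorder

module OrderedFieldRing {c ℓ} (F : OrderedField c ℓ) where
  open OrderedField F
  open ≡-Reasoning

  +-identityʳ : ∀ x → x + 0# ≡ x
  +-identityʳ x = trans (+-comm x 0#) (+-identityˡ x)

  *-identityʳ : ∀ x → x * 1# ≡ x
  *-identityʳ x = trans (*-comm x 1#) (*-identityˡ x)

  distribʳ : ∀ x y z → (y + z) * x ≡ y * x + z * x
  distribʳ x y z = begin
    (y + z) * x     ≡⟨ *-comm (y + z) x ⟩
    x * (y + z)     ≡⟨ distribˡ x y z ⟩
    x * y + x * z   ≡⟨ cong₂ _+_ (*-comm x y) (*-comm x z) ⟩
    y * x + z * x   ∎

  isCommutativeRing : IsCommutativeRing _≡_ _+_ _*_ (-_) 0# 1#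
  isCommutativeRing = record
    { isRing = record
      { +-isAbelianGroup = record
        { isGroup = record
          { isMonoid = record
            { isSemigroup = record
              { isMagma = record { isEquivalence = isEquivalence ; ∙-cong = cong₂ _+_ }
              ; assoc = +-assoc }
            ; identity = +-identityˡ , +-identityʳ }
          ; inverse = +-inverseˡ , λ x → trans (+-comm x (- x)) (+-inverseˡ x)
          ; ⁻¹-cong = cong (-_) }
        ; comm = +-comm }
      ; *-cong = cong₂ _*_
      ; *-assoc = *-assoc
      ; *-identity = *-identityˡ , *-identityʳ
      ; distrib = distribˡ , distribʳ }
    ; *-comm = *-comm }

  commutativeRing : CommutativeRing c c
  commutativeRing = record { isCommutativeRing = isCommutativeRing }

  open CommutativeRing commutativeRing using (ring; semiring; +-commutativeSemigroup; *-commutativeSemigroup; zeroʳ)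
  open CommutativeRing commutativeRing public using (zeroˡ)
  open RingProperties ring using (-‿involutive; -1*x≈-x; -0#≈0#; -‿+-comm)
  open SemiringMultTC semiring using (×-homo-+; ×1-homo-*; 1+×) renaming (_×_ to _×′_)
  open CommutativeSemigroupProperties +-commutativeSemigroup using () renaming (interchange to +-interchange)
  open CommutativeSemigroupProperties *-commutativeSemigroup using () renaming (interchange to *-interchange)
  open CommutativeSemigroupProperties *-commutativeSemigroup public using (x∙yz≈y∙xz)

  fromℕ≡×1 : ∀ n → fromℕ n ≡ SemiringMult._×_ semiring n 1#
  fromℕ≡×1 zero    = refl
  fromℕ≡×1 (suc n) = cong (1# +_) (fromℕ≡×1 n)

  fromℕ-+ : ∀ m n → fromℕ (m ℕ.+ n) ≡ fromℕ m + fromℕ n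
  fromℕ-+ m n = begin
    fromℕ (m ℕ.+ n) ≡⟨ fromℕ≡×1 (m ℕ.+ n) ⟩
    _               ≡⟨ SemiringMult.×-homo-+ semiring 1# m n ⟩
    _               ≡⟨ sym (cong₂ _+_ (fromℕ≡×1 m) (fromℕ≡×1 n)) ⟩
    fromℕ m + fromℕ n ∎

  fromℕ-* : ∀ m n → fromℕ (m ℕ.* n) ≡ fromℕ m * fromℕ n
  fromℕ-* m n = begin
    fromℕ (m ℕ.* n) ≡⟨ fromℕ≡×1 (m ℕ.* n) ⟩
    _               ≡⟨ SemiringMult.×1-homo-* semiring m n ⟩
    _               ≡⟨ sym (cong₂ _*_ (fromℕ≡×1 m) (fromℕ≡×1 n)) ⟩
    fromℕ m * fromℕ n ∎

  -- Unlike fromℕ, ι sends 1 to 1# on the nose, so that the solver constant 𝟙 below is 1#.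
  ι : ℕ → Carrier
  ι n = n ×′ 1#

  fromℤ : ℤ → Carrier
  fromℤ (pos n)    = ι n
  fromℤ -[1+ n ]   = - ι (suc n)

  fromℤ-⊖ : ∀ m n → fromℤ (m ⊖ n) ≡ ι m - ι n
  fromℤ-⊖ zero    zero    = sym (trans (cong (0# +_) -0#≈0#) (+-identityˡ 0#))
  fromℤ-⊖ (suc m) zero    = sym (trans (cong (ι (suc m) +_) -0#≈0#) (+-identityʳ _))
  fromℤ-⊖ zero    (suc n) = sym (+-identityˡ _)
  fromℤ-⊖ (suc m) (suc n) = begin
    fromℤ (suc m ⊖ suc n)                 ≡⟨ cong fromℤ (ℤ.[1+m]⊖[1+n]≡m⊖n m n) ⟩
    fromℤ (m ⊖ n)                         ≡⟨ fromℤ-⊖ m n ⟩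
    ι m - ι n                             ≡⟨ sym (+-identityˡ _) ⟩
    0# + (ι m - ι n)                      ≡⟨ cong (_+ (ι m - ι n)) (sym (trans (+-comm 1# (- 1#)) (+-inverseˡ 1#))) ⟩
    (1# - 1#) + (ι m - ι n)               ≡⟨ +-interchange 1# (- 1#) (ι m) (- ι n) ⟩
    (1# + ι m) + (- 1# + - ι n)           ≡⟨ cong₂ _+_ (sym (1+× m 1#)) (-‿+-comm 1# (ι n)) ⟩
    ι (suc m) + - (1# + ι n)              ≡⟨ cong (λ a → ι (suc m) - a) (sym (1+× n 1#)) ⟩
    ι (suc m) - ι (suc n)                 ∎

  fromℤ-+ : ∀ i j → fromℤ (i ℤ.+ j) ≡ fromℤ i + fromℤ j
  fromℤ-+ (pos m)  (pos n)  = ×-homo-+ 1# m n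
  fromℤ-+ (pos m)  -[1+ n ] = fromℤ-⊖ m (suc n)
  fromℤ-+ -[1+ m ] (pos n)  = trans (fromℤ-⊖ n (suc m)) (+-comm _ _)
  fromℤ-+ -[1+ m ] -[1+ n ] = begin
    - ι (suc (suc (m ℕ.+ n)))      ≡⟨ cong (λ k → - ι (suc k)) (sym (ℕ.+-suc m n)) ⟩
    - ι (suc m ℕ.+ suc n)          ≡⟨ cong (-_) (×-homo-+ 1# (suc m) (suc n)) ⟩
    - (ι (suc m) + ι (suc n))      ≡⟨ sym (-‿+-comm _ _) ⟩
    - ι (suc m) + - ι (suc n)      ∎

  signValue : Sign → Carrier
  signValue Sign.+ = 1#
  signValue Sign.- = - 1#

  signValue-* : ∀ s t → signValue (s Sign.* t) ≡ signValue s * signValue t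
  signValue-* Sign.+ t      = sym (*-identityˡ _)
  signValue-* Sign.- Sign.+ = sym (*-identityʳ _)
  signValue-* Sign.- Sign.- = sym (trans (-1*x≈-x (- 1#)) (-‿involutive 1#))

  fromℤ-◃ : ∀ s n → fromℤ (s ◃ n) ≡ signValue s * ι n
  fromℤ-◃ s      zero    = sym (zeroʳ _)
  fromℤ-◃ Sign.+ (suc n) = sym (*-identityˡ _)
  fromℤ-◃ Sign.- (suc n) = sym (-1*x≈-x _)

  fromℤ-* : ∀ i j → fromℤ (i ℤ.* j) ≡ fromℤ i * fromℤ j
  fromℤ-* i j = begin
    fromℤ (i ℤ.* j)                                             ≡⟨ fromℤ-◃ (sign i Sign.* sign j) (∣ i ∣ ℕ.* ∣ j ∣) ⟩
    signValue (sign i Sign.* sign j) * ι (∣ i ∣ ℕ.* ∣ j ∣)      ≡⟨ cong₂ _*_ (signValue-* (sign i) (sign j)) (×1-homo-* ∣ i ∣ ∣ j ∣) ⟩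
    (signValue (sign i) * signValue (sign j)) * (ι ∣ i ∣ * ι ∣ j ∣) ≡⟨ *-interchange _ _ _ _ ⟩
    (signValue (sign i) * ι ∣ i ∣) * (signValue (sign j) * ι ∣ j ∣) ≡⟨ sym (cong₂ _*_ (polar i) (polar j)) ⟩
    fromℤ i * fromℤ j                                           ∎
    where
    polar : ∀ k → fromℤ k ≡ signValue (sign k) * ι ∣ k ∣
    polar k = trans (cong fromℤ (sym (ℤ.◃-inverse k))) (fromℤ-◃ (sign k) ∣ k ∣)

  fromℤ-neg : ∀ i → fromℤ (ℤ.- i) ≡ - fromℤ i
  fromℤ-neg (pos zero)    = sym -0#≈0#
  fromℤ-neg (pos (suc n)) = refl
  fromℤ-neg -[1+ n ]      = sym (-‿involutive _)

  fromℤ-morphism : ACR._-Raw-AlmostCommutative⟶_ (CommutativeRing.rawRing ℤ.+-*-commutativeRing)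
                                                  (ACR.fromCommutativeRing commutativeRing)
  fromℤ-morphism = record
    { ⟦_⟧ = fromℤ ; +-homo = fromℤ-+ ; *-homo = fromℤ-* ; -‿homo = fromℤ-neg
    ; 0-homo = refl ; 1-homo = refl }

  fromℤ-≟ : ∀ i j → Maybe (fromℤ i ≡ fromℤ j)
  fromℤ-≟ i j with i ℤ.≟ j
  ... | yes refl = just refl
  ... | no _     = nothing

  open import Algebra.Solver.Ring (CommutativeRing.rawRing ℤ.+-*-commutativeRing)
    (ACR.fromCommutativeRing commutativeRing) fromℤ-morphism fromℤ-≟ public

  𝟙 : ∀ {n} → Polynomial n
  𝟙 = con (pos 1)

  -- # k denotes fromℕ k on the nose.
  #_ : ∀ {n} → ℕ → Polynomial n
  # k = k :× 𝟙

module OrderedFieldProperties {c ℓ} (F : OrderedField c ℓ) where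
  open OrderedField F
  open OrderedFieldRing F public
  open import Data.Sum using (inj₁; inj₂)
  open import Relation.Binary.Bundles using (Preorder)
  open ≡-Reasoning

  ≤-reflexive : ∀ {x y} → x ≡ y → x ≤ y
  ≤-reflexive refl = ≤-refl _

  ≤-preorder : Preorder c c ℓ
  ≤-preorder = record
    { Carrier = Carrier ; _≈_ = _≡_ ; _≲_ = _≤_
    ; isPreorder = record { isEquivalence = isEquivalence ; reflexive = ≤-reflexive ; trans = ≤-trans } }

  x≤y⇒0≤y-x : ∀ {x y} → x ≤ y → 0# ≤ y - x
  x≤y⇒0≤y-x {x} {y} x≤y =
    subst (_≤ y - x) (trans (+-comm x (- x)) (+-inverseˡ x)) (+-mono-≤ (- x) x≤y)

  0≤y-x⇒x≤y : ∀ {x y} → 0# ≤ y - x → x ≤ y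
  0≤y-x⇒x≤y {x} {y} 0≤y-x =
    subst₂ _≤_ (+-identityˡ x) (solve 2 (λ x y → (y :- x) :+ x := y) refl x y) (+-mono-≤ x 0≤y-x)

  ≤-from-diff : ∀ {x y t} → 0# ≤ t → t ≡ y - x → x ≤ y
  ≤-from-diff 0≤t refl = 0≤y-x⇒x≤y 0≤t

  +-nonneg : ∀ {x y} → 0# ≤ x → 0# ≤ y → 0# ≤ x + y
  +-nonneg {x} {y} 0≤x 0≤y = ≤-trans 0≤y (subst (_≤ x + y) (+-identityˡ y) (+-mono-≤ y 0≤x))

  0≤1 : 0# ≤ 1#
  0≤1 with ≤-total 0# 1#
  ... | inj₁ 0≤1 = 0≤1
  ... | inj₂ 1≤0 = subst (0# ≤_) (solve 0 ((# 0 :- 𝟙) :* (# 0 :- 𝟙) := 𝟙) refl) (*-nonneg 0≤-1 0≤-1)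
    where
    0≤-1 : 0# ≤ 0# - 1#
    0≤-1 = x≤y⇒0≤y-x 1≤0

  0≤fromℕ : ∀ n → 0# ≤ fromℕ n
  0≤fromℕ zero    = ≤-refl 0#
  0≤fromℕ (suc n) = +-nonneg 0≤1 (0≤fromℕ n)

  fromℕ-mono : ∀ {m n} → m ℕ.≤ n → fromℕ m ≤ fromℕ n
  fromℕ-mono {m} {n} m≤n = ≤-from-diff (0≤fromℕ (n ℕ.∸ m)) (begin
    fromℕ (n ℕ.∸ m)                        ≡⟨ solve 2 (λ a b → b := (a :+ b) :- a) refl (fromℕ m) (fromℕ (n ℕ.∸ m)) ⟩
    (fromℕ m + fromℕ (n ℕ.∸ m)) - fromℕ m  ≡⟨ cong (_- fromℕ m) (sym (fromℕ-+ m (n ℕ.∸ m))) ⟩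
    fromℕ (m ℕ.+ (n ℕ.∸ m)) - fromℕ m      ≡⟨ cong (λ k → fromℕ k - fromℕ m) (ℕ.m+[n∸m]≡n m≤n) ⟩
    fromℕ n - fromℕ m                      ∎)

  0≤x⇒1≤1+x : ∀ {x} → 0# ≤ x → 1# ≤ 1# + x
  0≤x⇒1≤1+x {x} 0≤x = ≤-from-diff 0≤x (solve 1 (λ x → x := (𝟙 :+ x) :- 𝟙) refl x)

  0<⇒≢0 : ∀ {x} → 0# < x → x ≢ 0#
  0<⇒≢0 (_ , 0≢x) x≡0 = 0≢x (sym x≡0)

  1≤⇒0< : ∀ {x} → 1# ≤ x → 0# < x
  1≤⇒0< 1≤x = ≤-trans 0≤1 1≤x , λ { refl → 0≢1 (≤-antisym 0≤1 1≤x) }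

  0<fromℕ-suc : ∀ n → 0# < fromℕ (suc n)
  0<fromℕ-suc n = 1≤⇒0< (0≤x⇒1≤1+x (0≤fromℕ n))

  fin⇒0<fromℕ : ∀ {n} → Fin n → 0# < fromℕ n
  fin⇒0<fromℕ {suc n} _ = 0<fromℕ-suc n

  *-monoˡ-≤ : ∀ {x y z} → 0# ≤ z → x ≤ y → z * x ≤ z * y
  *-monoˡ-≤ {x} {y} {z} 0≤z x≤y = ≤-from-diff (*-nonneg 0≤z (x≤y⇒0≤y-x x≤y))
    (solve 3 (λ x y z → z :* (y :- x) := z :* y :- z :* x) refl x y z)

  *-cancelˡ-nonneg : ∀ {x z} → 0# < x → 0# ≤ x * z → 0# ≤ z
  *-cancelˡ-nonneg {x} {z} 0<x 0≤xz with ≤-total 0# z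
  ... | inj₁ 0≤z = 0≤z
  ... | inj₂ z≤0 = ≤-reflexive (sym z≡0)
    where
    xz≡0 : x * z ≡ 0#
    xz≡0 = ≤-antisym (≤-from-diff (*-nonneg (proj₁ 0<x) (x≤y⇒0≤y-x z≤0))
                       (solve 2 (λ x z → x :* (# 0 :- z) := # 0 :- x :* z) refl x z)) 0≤xz
    z≡0 : z ≡ 0#
    z≡0 = begin
      z                    ≡⟨ solve 3 (λ x x⁻¹ z → z := x⁻¹ :* (x :* z) :+ z :* (𝟙 :- x :* x⁻¹)) refl x (x ⁻¹) z ⟩
      x ⁻¹ * (x * z) + z * (1# - x * x ⁻¹) ≡⟨ cong₂ (λ a b → x ⁻¹ * a + z * (1# - b)) xz≡0 (*-inverseʳ x (0<⇒≢0 0<x)) ⟩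
      x ⁻¹ * 0# + z * (1# - 1#) ≡⟨ solve 2 (λ x⁻¹ z → x⁻¹ :* # 0 :+ z :* (𝟙 :- 𝟙) := # 0) refl (x ⁻¹) z ⟩
      0#                   ∎

  *-pos : ∀ {x y} → 0# < x → 0# < y → 0# < x * y
  *-pos {x} {y} 0<x 0<y = *-nonneg (proj₁ 0<x) (proj₁ 0<y) , λ 0≡xy → 0<⇒≢0 0<x (begin
    x                ≡⟨ sym (*-identityʳ x) ⟩
    x * 1#           ≡⟨ cong (x *_) (sym (*-inverseʳ y (0<⇒≢0 0<y))) ⟩
    x * (y * y ⁻¹)   ≡⟨ sym (*-assoc x y (y ⁻¹)) ⟩
    (x * y) * y ⁻¹   ≡⟨ cong (_* y ⁻¹) (sym 0≡xy) ⟩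
    0# * y ⁻¹        ≡⟨ zeroˡ (y ⁻¹) ⟩
    0#               ∎)

  ⁻¹-nonneg : ∀ {x} → 0# < x → 0# ≤ x ⁻¹
  ⁻¹-nonneg {x} 0<x = *-cancelˡ-nonneg 0<x (subst (0# ≤_) (sym (*-inverseʳ x (0<⇒≢0 0<x))) 0≤1)

module RelativeDeviation {c ℓ} (F : OrderedField c ℓ) where
  open OrderedField F
  open OrderedFieldProperties F

  Near : Carrier → Carrier → Carrier → Set ℓ
  Near δ x y = (y - x ≤ δ * x) × (x - y ≤ δ * x)

  -- q / p ∈ [1 - 2δ, (1 + δ) / (1 - δ)]: weak enough to hold for all three reactant shapes,
  -- strong enough to give Bracketed ρ p q when 2δ (1 + ρ) ≤ ρ.
  Distorted : Carrier → Carrier → Carrier → Set ℓ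
  Distorted δ p q = ((1# - fromℕ 2 * δ) * p ≤ q) × ((1# - δ) * q ≤ (1# + δ) * p)

  Bracketed : Carrier → Carrier → Carrier → Set ℓ
  Bracketed ρ p q = ((1# - ρ) * q ≤ p) × (p ≤ (1# + ρ) * q)

  distorted-*ˡ : ∀ {δ p q k} → 0# ≤ k → Distorted δ p q → Distorted δ (k * p) (k * q)
  distorted-*ˡ {δ} {p} {q} {k} 0≤k (lower , upper) =
      subst (_≤ k * q) (x∙yz≈y∙xz k (1# - fromℕ 2 * δ) p) (*-monoˡ-≤ 0≤k lower)
    , subst₂ _≤_ (x∙yz≈y∙xz k (1# - δ) q) (x∙yz≈y∙xz k (1# + δ) p) (*-monoˡ-≤ 0≤k upper)

  distorted-*ʳ : ∀ {δ p q w} → 0# ≤ w → Distorted δ p q → Distorted δ (p * w) (q * w)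
  distorted-*ʳ {δ} {p} {q} {w} 0≤w d =
    subst₂ (Distorted δ) (*-comm w p) (*-comm w q) (distorted-*ˡ 0≤w d)

  module _ {δ : Carrier} (0≤δ : 0# ≤ δ) (0≤1-2δ : 0# ≤ 1# - fromℕ 2 * δ) where

    0≤1-δ : 0# ≤ 1# - δ
    0≤1-δ = subst (0# ≤_) (solve 1 (λ δ → (𝟙 :- # 2 :* δ) :+ δ := 𝟙 :- δ) refl δ) (+-nonneg 0≤1-2δ 0≤δ)

    distorted-refl : ∀ {p} → 0# ≤ p → Distorted δ p p
    distorted-refl {p} 0≤p =
        ≤-from-diff (*-nonneg (*-nonneg (0≤fromℕ 2) 0≤δ) 0≤p) (solve 2 (λ δ p → (# 2 :* δ) :* p := p :- (𝟙 :- # 2 :* δ) :* p) refl δ p)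
      , ≤-from-diff (*-nonneg (*-nonneg (0≤fromℕ 2) 0≤δ) 0≤p) (solve 2 (λ δ p → (# 2 :* δ) :* p := (𝟙 :+ δ) :* p :- (𝟙 :- δ) :* p) refl δ p)

    near⇒distorted : ∀ {x y} → 0# ≤ x → 0# ≤ y → Near δ x y → Distorted δ x y
    near⇒distorted {x} {y} 0≤x 0≤y (y-x≤δx , x-y≤δx) =
        ≤-from-diff (+-nonneg (x≤y⇒0≤y-x x-y≤δx) (*-nonneg 0≤δ 0≤x))
          (solve 3 (λ δ x y → (δ :* x :- (x :- y)) :+ δ :* x := y :- (𝟙 :- # 2 :* δ) :* x) refl δ x y)
      , ≤-from-diff (+-nonneg (x≤y⇒0≤y-x y-x≤δx) (*-nonneg 0≤δ 0≤y))
          (solve 3 (λ δ x y → (δ :* x :- (y :- x)) :+ δ :* y := (𝟙 :+ δ) :* x :- (𝟙 :- δ) :* y) refl δ x y)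

    near-*⇒distorted : ∀ {x x′ y y′} → 0# ≤ x → 0# ≤ x′ → 0# ≤ y′ →
      Near δ x y → Near δ x′ y′ → Distorted δ (x * x′) (y * y′)
    near-*⇒distorted {x} {x′} {y} {y′} 0≤x 0≤x′ 0≤y′ (y-x≤δx , x-y≤δx) (y′-x′≤δx′ , x′-y′≤δx′) =
        ≤-from-diff
          (+-nonneg (+-nonneg (*-nonneg (x≤y⇒0≤y-x x-y≤δx) 0≤y′)
                              (*-nonneg (*-nonneg 0≤1-δ 0≤x) (x≤y⇒0≤y-x x′-y′≤δx′)))
                    (*-nonneg (*-nonneg 0≤δ 0≤δ) (*-nonneg 0≤x 0≤x′)))
          (solve 5 (λ δ x x′ y y′ →
              ((δ :* x :- (x :- y)) :* y′ :+ ((𝟙 :- δ) :* x) :* (δ :* x′ :- (x′ :- y′))) :+ (δ :* δ) :* (x :* x′)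
            := y :* y′ :- (𝟙 :- # 2 :* δ) :* (x :* x′)) refl δ x x′ y y′)
      , ≤-from-diff
          (+-nonneg (*-nonneg 0≤1-δ (+-nonneg (*-nonneg (x≤y⇒0≤y-x y-x≤δx) 0≤y′)
                                              (*-nonneg (*-nonneg 0≤1+δ 0≤x) (x≤y⇒0≤y-x y′-x′≤δx′))))
                    (*-nonneg (*-nonneg 0≤δ 0≤δ) (*-nonneg 0≤1+δ (*-nonneg 0≤x 0≤x′))))
          (solve 5 (λ δ x x′ y y′ →
              (𝟙 :- δ) :* ((δ :* x :- (y :- x)) :* y′ :+ ((𝟙 :+ δ) :* x) :* (δ :* x′ :- (y′ :- x′)))
                :+ (δ :* δ) :* ((𝟙 :+ δ) :* (x :* x′))
            := (𝟙 :+ δ) :* (x :* x′) :- (𝟙 :- δ) :* (y :* y′)) refl δ x x′ y y′)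
      where
      0≤1+δ : 0# ≤ 1# + δ
      0≤1+δ = +-nonneg 0≤1 0≤δ

    near-dimer⇒distorted : ∀ {x y} → 0# ≤ x → 1# ≤ δ * x →
      Near δ x y → Distorted δ (x * (x - 1#)) (y * (y - 1#))
    near-dimer⇒distorted {x} {y} 0≤x 1≤δx (y-x≤δx , x-y≤δx) =
        ≤-from-diff (+-nonneg (*-nonneg 0≤δx-[x-y] 0≤y-1) (*-nonneg 0≤x (x≤y⇒0≤y-x [1-2δ][x-1]≤[1-δ][y-1])))
          (solve 3 (λ δ x y →
              (δ :* x :- (x :- y)) :* (y :- 𝟙) :+ x :* ((𝟙 :- δ) :* (y :- 𝟙) :- (𝟙 :- # 2 :* δ) :* (x :- 𝟙))
            := y :* (y :- 𝟙) :- (𝟙 :- # 2 :* δ) :* (x :* (x :- 𝟙))) refl δ x y)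
      , ≤-from-diff (+-nonneg (*-nonneg (*-nonneg (+-nonneg 0≤1 0≤δ) 0≤x) (x≤y⇒0≤y-x [1-δ][y-1]≤x-1))
                              (*-nonneg (*-nonneg 0≤1-δ 0≤y-1) (x≤y⇒0≤y-x y-x≤δx)))
          (solve 3 (λ δ x y →
              ((𝟙 :+ δ) :* x) :* ((x :- 𝟙) :- (𝟙 :- δ) :* (y :- 𝟙)) :+ ((𝟙 :- δ) :* (y :- 𝟙)) :* (δ :* x :- (y :- x))
            := (𝟙 :+ δ) :* (x :* (x :- 𝟙)) :- (𝟙 :- δ) :* (y :* (y :- 𝟙))) refl δ x y)
      where
      0≤δx-1 : 0# ≤ δ * x - 1#
      0≤δx-1 = x≤y⇒0≤y-x 1≤δx
      0≤δx-[x-y] : 0# ≤ δ * x - (x - y)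
      0≤δx-[x-y] = x≤y⇒0≤y-x x-y≤δx
      0≤y-1 : 0# ≤ y - 1#
      0≤y-1 = subst (0# ≤_)
        (solve 3 (λ δ x y → ((δ :* x :- (x :- y)) :+ (𝟙 :- # 2 :* δ) :* x) :+ (δ :* x :- 𝟙) := y :- 𝟙) refl δ x y)
        (+-nonneg (+-nonneg 0≤δx-[x-y] (*-nonneg 0≤1-2δ 0≤x)) 0≤δx-1)
      -- The shift by one is absorbed through δ x ≥ 1, in the form (1 - δ) δ x ≤ δ (x - 1).
      [1-2δ][x-1]≤[1-δ][y-1] : (1# - fromℕ 2 * δ) * (x - 1#) ≤ (1# - δ) * (y - 1#)
      [1-2δ][x-1]≤[1-δ][y-1] = ≤-from-diff (+-nonneg (*-nonneg 0≤1-δ 0≤δx-[x-y]) (*-nonneg 0≤δ 0≤δx-1))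
        (solve 3 (λ δ x y → (𝟙 :- δ) :* (δ :* x :- (x :- y)) :+ δ :* (δ :* x :- 𝟙)
                         := (𝟙 :- δ) :* (y :- 𝟙) :- (𝟙 :- # 2 :* δ) :* (x :- 𝟙)) refl δ x y)
      [1-δ][y-1]≤x-1 : (1# - δ) * (y - 1#) ≤ x - 1#
      [1-δ][y-1]≤x-1 = ≤-from-diff (+-nonneg (*-nonneg 0≤1-δ (x≤y⇒0≤y-x y-x≤δx)) (*-nonneg 0≤δ 0≤δx-1))
        (solve 3 (λ δ x y → (𝟙 :- δ) :* (δ :* x :- (y :- x)) :+ δ :* (δ :* x :- 𝟙)
                         := (x :- 𝟙) :- (𝟙 :- δ) :* (y :- 𝟙)) refl δ x y)

  module _ {δ ρ : Carrier} (0≤δ : 0# ≤ δ) (0≤ρ : 0# ≤ ρ) (ρ≤1 : ρ ≤ 1#)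
           (2δ[1+ρ]≤ρ : fromℕ 2 * δ * (1# + ρ) ≤ ρ) where

    0≤1-2δ : 0# ≤ 1# - fromℕ 2 * δ
    0≤1-2δ = subst (0# ≤_)
      (solve 2 (λ δ ρ → ((𝟙 :- ρ) :+ (ρ :- # 2 :* δ :* (𝟙 :+ ρ))) :+ (# 2 :* δ) :* ρ := 𝟙 :- # 2 :* δ) refl δ ρ)
      (+-nonneg (+-nonneg (x≤y⇒0≤y-x ρ≤1) (x≤y⇒0≤y-x 2δ[1+ρ]≤ρ)) (*-nonneg (*-nonneg (0≤fromℕ 2) 0≤δ) 0≤ρ))

    distorted⇒bracketed : ∀ {p q} → 0# ≤ p → Distorted δ p q → Bracketed ρ p q
    distorted⇒bracketed {p} {q} 0≤p ([1-2δ]p≤q , [1-δ]q≤[1+δ]p) =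
        0≤y-x⇒x≤y (*-cancelˡ-nonneg 0<2[1-δ] (subst (0# ≤_)
          (solve 4 (λ δ ρ p q →
              (# 2 :* (𝟙 :- ρ) :* ((𝟙 :+ δ) :* p :- (𝟙 :- δ) :* q) :+ # 2 :* (ρ :- # 2 :* δ :* (𝟙 :+ ρ)) :* p)
                :+ # 6 :* ρ :* δ :* p
            := # 2 :* (𝟙 :- δ) :* (p :- (𝟙 :- ρ) :* q)) refl δ ρ p q)
          (+-nonneg (+-nonneg (*-nonneg (*-nonneg (0≤fromℕ 2) (x≤y⇒0≤y-x ρ≤1)) (x≤y⇒0≤y-x [1-δ]q≤[1+δ]p))
                              (*-nonneg (*-nonneg (0≤fromℕ 2) (x≤y⇒0≤y-x 2δ[1+ρ]≤ρ)) 0≤p))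
                    (*-nonneg (*-nonneg (*-nonneg (0≤fromℕ 6) 0≤ρ) 0≤δ) 0≤p))))
      , ≤-from-diff
          (+-nonneg (*-nonneg (+-nonneg 0≤1 0≤ρ) (x≤y⇒0≤y-x [1-2δ]p≤q)) (*-nonneg (x≤y⇒0≤y-x 2δ[1+ρ]≤ρ) 0≤p))
          (solve 4 (λ δ ρ p q →
              (𝟙 :+ ρ) :* (q :- (𝟙 :- # 2 :* δ) :* p) :+ (ρ :- # 2 :* δ :* (𝟙 :+ ρ)) :* p
            := (𝟙 :+ ρ) :* q :- p) refl δ ρ p q)
      where
      0<2[1-δ] : 0# < fromℕ 2 * (1# - δ)
      0<2[1-δ] = 1≤⇒0< (≤-from-diff 0≤1-2δ
        (solve 1 (λ δ → 𝟙 :- # 2 :* δ := # 2 :* (𝟙 :- δ) :- 𝟙) refl δ))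

module Propensities {c ℓ} (F : OrderedField c ℓ) where
  open OrderedField F
  open OrderedFieldProperties F
  open RelativeDeviation F
  open import Relation.Binary.Definitions using (tri<; tri≈; tri>)

  fromℕ-dimer : ∀ n → fromℕ (n ℕ.* (n ℕ.∸ 1)) ≡ fromℕ n * (fromℕ n - 1#)
  fromℕ-dimer zero    = sym (zeroˡ _)
  fromℕ-dimer (suc n) = trans (fromℕ-* (suc n) n)
    (solve 1 (λ a → (𝟙 :+ a) :* a := (𝟙 :+ a) :* ((𝟙 :+ a) :- 𝟙)) refl (fromℕ n))

  near-distinct⇒1≤δx : ∀ {δ a b} → Near δ (fromℕ a) (fromℕ b) → a ≢ b → 1# ≤ δ * fromℕ a
  near-distinct⇒1≤δx {δ} {a} {b} (b-a≤δa , a-b≤δa) a≢b with ℕ.<-cmp a b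
  ... | tri≈ _ a≡b _ = ⊥-elim (a≢b a≡b)
  ... | tri< a<b _ _ = ≤-from-diff (+-nonneg (x≤y⇒0≤y-x b-a≤δa) (x≤y⇒0≤y-x (fromℕ-mono a<b)))
    (solve 3 (λ δ a b → (δ :* a :- (b :- a)) :+ (b :- (𝟙 :+ a)) := δ :* a :- 𝟙) refl δ (fromℕ a) (fromℕ b))
  ... | tri> _ _ b<a = ≤-from-diff (+-nonneg (x≤y⇒0≤y-x a-b≤δa) (x≤y⇒0≤y-x (fromℕ-mono b<a)))
    (solve 3 (λ δ a b → (δ :* a :- (a :- b)) :+ (a :- (𝟙 :+ b)) := δ :* a :- 𝟙) refl δ (fromℕ a) (fromℕ b))

  0≤[2V]⁻¹ : ∀ {V} → 0# < V → 0# ≤ (fromℕ 2 * V) ⁻¹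
  0≤[2V]⁻¹ 0<V = ⁻¹-nonneg (*-pos (0<fromℕ-suc 1) 0<V)

  propensityR-nonneg : ∀ {N} (R : Reactants N) {k V} → 0# ≤ k → 0# < V → (x : State N) →
    0# ≤ propensityR F R k V x
  propensityR-nonneg (uni i)     0≤k 0<V x = *-nonneg 0≤k (0≤fromℕ (x i))
  propensityR-nonneg (bi i i′ _) 0≤k 0<V x = *-nonneg (*-nonneg 0≤k (0≤fromℕ (x i ℕ.* x i′))) (⁻¹-nonneg 0<V)
  propensityR-nonneg (dimer i)   0≤k 0<V x = *-nonneg (*-nonneg 0≤k (0≤fromℕ (x i ℕ.* (x i ℕ.∸ 1)))) (0≤[2V]⁻¹ 0<V)

  module _ {δ : Carrier} (0≤δ : 0# ≤ δ) (0≤1-2δ : 0# ≤ 1# - fromℕ 2 * δ) where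

    propensityR-distorted : ∀ {N} (R : Reactants N) {k V} → 0# ≤ k → 0# < V → (x y : State N) →
      (∀ i → Near δ (fromℕ (x i)) (fromℕ (y i))) →
      Distorted δ (propensityR F R k V x) (propensityR F R k V y)
    propensityR-distorted (uni i) 0≤k 0<V x y near =
      distorted-*ˡ 0≤k (near⇒distorted 0≤δ 0≤1-2δ (0≤fromℕ (x i)) (0≤fromℕ (y i)) (near i))
    propensityR-distorted (bi i i′ _) {k} {V} 0≤k 0<V x y near =
      subst₂ (λ p q → Distorted δ ((k * p) * V ⁻¹) ((k * q) * V ⁻¹))
        (sym (fromℕ-* (x i) (x i′))) (sym (fromℕ-* (y i) (y i′)))
        (distorted-*ʳ (⁻¹-nonneg 0<V) (distorted-*ˡ 0≤k
          (near-*⇒distorted 0≤δ 0≤1-2δ (0≤fromℕ (x i)) (0≤fromℕ (x i′)) (0≤fromℕ (y i′)) (near i) (near i′))))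
    propensityR-distorted (dimer i) {k} {V} 0≤k 0<V x y near with x i ℕ.≟ y i
    ... | yes xᵢ≡yᵢ rewrite xᵢ≡yᵢ = distorted-refl 0≤δ 0≤1-2δ (propensityR-nonneg (dimer i) 0≤k 0<V y)
    ... | no xᵢ≢yᵢ =
      subst₂ (λ p q → Distorted δ ((k * p) * (fromℕ 2 * V) ⁻¹) ((k * q) * (fromℕ 2 * V) ⁻¹))
        (sym (fromℕ-dimer (x i))) (sym (fromℕ-dimer (y i)))
        (distorted-*ʳ (0≤[2V]⁻¹ 0<V) (distorted-*ˡ 0≤k
          (near-dimer⇒distorted 0≤δ 0≤1-2δ (0≤fromℕ (x i)) (near-distinct⇒1≤δx (near i) xᵢ≢yᵢ) (near i))))

module StepSize {c ℓ} (F : OrderedField c ℓ) where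
  open OrderedField F
  open OrderedFieldProperties F

  ε-bound⇒4δ≤3[1-s] : ∀ {m ε s} → 0# < m → ε ≤ (fromℕ 3 / (fromℕ 4 * m)) * (1# - s) →
    fromℕ 4 * (m * ε) ≤ fromℕ 3 * (1# - s)
  ε-bound⇒4δ≤3[1-s] {m} {ε} {s} 0<m ε≤ = begin
    fromℕ 4 * (m * ε)              ≡⟨ sym (*-assoc (fromℕ 4) m ε) ⟩
    q * ε                          ≲⟨ *-monoˡ-≤ (proj₁ 0<q) ε≤ ⟩
    q * ((fromℕ 3 * q ⁻¹) * (1# - s)) ≡⟨ solve 3 (λ q q⁻¹ s → q :* ((# 3 :* q⁻¹) :* (𝟙 :- s)) := # 3 :* (𝟙 :- s) :* (q :* q⁻¹)) refl q (q ⁻¹) s ⟩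
    fromℕ 3 * (1# - s) * (q * q ⁻¹) ≡⟨ cong (fromℕ 3 * (1# - s) *_) (*-inverseʳ q (0<⇒≢0 0<q)) ⟩
    fromℕ 3 * (1# - s) * 1#         ≡⟨ *-identityʳ _ ⟩
    fromℕ 3 * (1# - s)              ∎
    where
    open Relation.Binary.Reasoning.Preorder ≤-preorder
    q : Carrier
    q = fromℕ 4 * m
    0<q : 0# < q
    0<q = *-pos (0<fromℕ-suc 3) 0<m

  s²≡⇒9[1+ρ]s²≡9+ρ : ∀ {ρ s} → 0# ≤ ρ → s * s ≡ (1# + ρ / fromℕ 9) / (1# + ρ) →
    fromℕ 9 * (1# + ρ) * (s * s) ≡ fromℕ 9 + ρ
  s²≡⇒9[1+ρ]s²≡9+ρ {ρ} {s} 0≤ρ s²≡ = begin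
    fromℕ 9 * (1# + ρ) * (s * s)
      ≡⟨ cong (fromℕ 9 * (1# + ρ) *_) s²≡ ⟩
    fromℕ 9 * (1# + ρ) * ((1# + ρ * fromℕ 9 ⁻¹) * (1# + ρ) ⁻¹)
      ≡⟨ solve 3 (λ ρ n r → # 9 :* (𝟙 :+ ρ) :* ((𝟙 :+ ρ :* n) :* r) := ((𝟙 :+ ρ) :* r) :* (# 9 :+ ρ :* (# 9 :* n)))
               refl ρ (fromℕ 9 ⁻¹) ((1# + ρ) ⁻¹) ⟩
    ((1# + ρ) * (1# + ρ) ⁻¹) * (fromℕ 9 + ρ * (fromℕ 9 * fromℕ 9 ⁻¹))
      ≡⟨ cong₂ (λ a b → a * (fromℕ 9 + ρ * b))
               (*-inverseʳ (1# + ρ) (0<⇒≢0 (1≤⇒0< (0≤x⇒1≤1+x 0≤ρ)))) (*-inverseʳ (fromℕ 9) (0<⇒≢0 (0<fromℕ-suc 8))) ⟩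
    1# * (fromℕ 9 + ρ * 1#)
      ≡⟨ solve 1 (λ ρ → 𝟙 :* (# 9 :+ ρ :* 𝟙) := # 9 :+ ρ) refl ρ ⟩
    fromℕ 9 + ρ ∎
    where open ≡-Reasoning

  1≤3s : ∀ {ρ s} → 0# ≤ ρ → 0# ≤ s → fromℕ 9 * (1# + ρ) * (s * s) ≡ fromℕ 9 + ρ → 1# ≤ fromℕ 3 * s
  1≤3s {ρ} {s} 0≤ρ 0≤s 9[1+ρ]s²≡9+ρ =
    0≤y-x⇒x≤y (*-cancelˡ-nonneg 0<b (subst (0# ≤_) (sym b[3s-1]≡8) (0≤fromℕ 8)))
    where
    open ≡-Reasoning
    b : Carrier
    b = (1# + ρ) * (1# + fromℕ 3 * s)
    0<b : 0# < b
    0<b = *-pos (1≤⇒0< (0≤x⇒1≤1+x 0≤ρ)) (1≤⇒0< (0≤x⇒1≤1+x (*-nonneg (0≤fromℕ 3) 0≤s)))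
    b[3s-1]≡8 : b * (fromℕ 3 * s - 1#) ≡ fromℕ 8
    b[3s-1]≡8 = begin
      b * (fromℕ 3 * s - 1#)
        ≡⟨ solve 2 (λ ρ s → (𝟙 :+ ρ) :* (𝟙 :+ # 3 :* s) :* (# 3 :* s :- 𝟙) := # 9 :* (𝟙 :+ ρ) :* (s :* s) :- (𝟙 :+ ρ)) refl ρ s ⟩
      fromℕ 9 * (1# + ρ) * (s * s) - (1# + ρ)
        ≡⟨ cong (_- (1# + ρ)) 9[1+ρ]s²≡9+ρ ⟩
      (fromℕ 9 + ρ) - (1# + ρ)
        ≡⟨ solve 1 (λ ρ → (# 9 :+ ρ) :- (𝟙 :+ ρ) := # 8) refl ρ ⟩
      fromℕ 8 ∎

  4δ≤3[1-s]⇒2δ[1+ρ]≤ρ : ∀ {δ ρ s} → 0# ≤ ρ → 0# ≤ s → fromℕ 9 * (1# + ρ) * (s * s) ≡ fromℕ 9 + ρ →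
    fromℕ 4 * δ ≤ fromℕ 3 * (1# - s) → fromℕ 2 * δ * (1# + ρ) ≤ ρ
  4δ≤3[1-s]⇒2δ[1+ρ]≤ρ {δ} {ρ} {s} 0≤ρ 0≤s 9[1+ρ]s²≡9+ρ 4δ≤3[1-s] =
    0≤y-x⇒x≤y (*-cancelˡ-nonneg 0<18[1+s] (subst (0# ≤_) certificate
      (+-nonneg (*-nonneg (*-nonneg (0≤fromℕ 6) 0≤ρ) (x≤y⇒0≤y-x (1≤3s 0≤ρ 0≤s 9[1+ρ]s²≡9+ρ)))
                (*-nonneg (*-nonneg (*-nonneg (0≤fromℕ 9) (+-nonneg 0≤1 0≤s)) (+-nonneg 0≤1 0≤ρ))
                          (x≤y⇒0≤y-x 4δ≤3[1-s])))))
    where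
    open ≡-Reasoning
    0<18[1+s] : 0# < fromℕ 18 * (1# + s)
    0<18[1+s] = *-pos (0<fromℕ-suc 17) (1≤⇒0< (0≤x⇒1≤1+x 0≤s))
    certificate : fromℕ 6 * ρ * (fromℕ 3 * s - 1#) + fromℕ 9 * (1# + s) * (1# + ρ) * (fromℕ 3 * (1# - s) - fromℕ 4 * δ)
                ≡ fromℕ 18 * (1# + s) * (ρ - fromℕ 2 * δ * (1# + ρ))
    certificate = begin
      fromℕ 6 * ρ * (fromℕ 3 * s - 1#) + fromℕ 9 * (1# + s) * (1# + ρ) * (fromℕ 3 * (1# - s) - fromℕ 4 * δ)
        ≡⟨ solve 3 (λ δ ρ s →
             # 6 :* ρ :* (# 3 :* s :- 𝟙) :+ # 9 :* (𝟙 :+ s) :* (𝟙 :+ ρ) :* (# 3 :* (𝟙 :- s) :- # 4 :* δ)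
           := # 18 :* (𝟙 :+ s) :* (ρ :- # 2 :* δ :* (𝟙 :+ ρ)) :+ # 3 :* ((# 9 :+ ρ) :- # 9 :* (𝟙 :+ ρ) :* (s :* s)))
           refl δ ρ s ⟩
      fromℕ 18 * (1# + s) * (ρ - fromℕ 2 * δ * (1# + ρ)) + fromℕ 3 * ((fromℕ 9 + ρ) - fromℕ 9 * (1# + ρ) * (s * s))
        ≡⟨ cong (λ t → fromℕ 18 * (1# + s) * (ρ - fromℕ 2 * δ * (1# + ρ)) + fromℕ 3 * ((fromℕ 9 + ρ) - t)) 9[1+ρ]s²≡9+ρ ⟩
      fromℕ 18 * (1# + s) * (ρ - fromℕ 2 * δ * (1# + ρ)) + fromℕ 3 * ((fromℕ 9 + ρ) - (fromℕ 9 + ρ))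
        ≡⟨ solve 2 (λ a b → a :+ # 3 :* (b :- b) := a) refl (fromℕ 18 * (1# + s) * (ρ - fromℕ 2 * δ * (1# + ρ))) (fromℕ 9 + ρ) ⟩
      fromℕ 18 * (1# + s) * (ρ - fromℕ 2 * δ * (1# + ρ)) ∎

mainTheorem12 : ∀ {c ℓ} (F : OrderedField c ℓ) → let open OrderedField F in
    (C : SCRN F) (V ρ ε s : Carrier) →
    0# < V → 0# < ρ → ρ < 1# → 0# < ε →
    0# ≤ s → s * s ≡ (1# + ρ / fromℕ 9) / (1# + ρ) →
    ε ≤ (fromℕ 3 / (fromℕ 4 * fromℕ (SCRN.M C))) * (1# - s) →
    (x y : State (SCRN.N C)) →
    (∀ i → (fromℕ (y i) - fromℕ (x i) ≤ fromℕ (SCRN.M C) * ε * fromℕ (x i))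
    × (fromℕ (x i) - fromℕ (y i) ≤ fromℕ (SCRN.M C) * ε * fromℕ (x i))) →
    ∀ (j : Fin (SCRN.M C)) →
    ((1# - ρ) * propensity F (SCRN.reactions C j) V y ≤ propensity F (SCRN.reactions C j) V x)
    × (propensity F (SCRN.reactions C j) V x ≤ (1# + ρ) * propensity F (SCRN.reactions C j) V y)
mainTheorem12 F C V ρ ε s 0<V (0≤ρ , _) (ρ≤1 , _) (0≤ε , _) 0≤s s²≡ ε≤ x y near j =
  distorted⇒bracketed 0≤δ 0≤ρ ρ≤1 2δ[1+ρ]≤ρ (propensityR-nonneg R 0≤k 0<V x)
    (propensityR-distorted 0≤δ (0≤1-2δ 0≤δ 0≤ρ ρ≤1 2δ[1+ρ]≤ρ) R 0≤k 0<V x y near)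
  where
  open OrderedField F
  open OrderedFieldProperties F
  open RelativeDeviation F
  open Propensities F
  open StepSize F
  R : Reactants (SCRN.N C)
  R = Reaction.reactants (SCRN.reactions C j)
  0≤k : 0# ≤ Reaction.rate (SCRN.reactions C j)
  0≤k = proj₁ (Reaction.rate-pos (SCRN.reactions C j))
  δ : Carrier
  δ = fromℕ (SCRN.M C) * ε
  0≤δ : 0# ≤ δ
  0≤δ = *-nonneg (0≤fromℕ (SCRN.M C)) 0≤ε
  2δ[1+ρ]≤ρ : fromℕ 2 * δ * (1# + ρ) ≤ ρ
  2δ[1+ρ]≤ρ = 4δ≤3[1-s]⇒2δ[1+ρ]≤ρ 0≤ρ 0≤s (s²≡⇒9[1+ρ]s²≡9+ρ 0≤ρ s²≡)
                (ε-bound⇒4δ≤3[1-s] (fin⇒0<fromℕ j) ε≤)
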